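{- Let $(D,r)$ be a rooted digraph and let $(u,v)$ be a cut-edge of $D$ such that $(v,u)\in E(D)$. Let $D'=D-(v,u)$. Then for every integer $k\ge 0$, $D$ has an outbranching rooted at $r$ with at least $k$ leaves if and only if $D'$ does.
   Context: A rooted digraph $(D,r)$ is a finite digraph without loops or parallel arcs with a root $r$ of in-degree $0$. A cut-edge is an arc $e$ such that some vertex is not reachable from $r$ in $D-e$. An outbranching rooted at $r$ is a spanning subgraph whose underlying undirected graph is a tree with arcs oriented away from $r$; leaves are vertices of out-degree $0$ in it. -}

module Defs where

open import Data.Nat using (ℕ)
open import Data.Fin using (Fin)
open import Data.Product using (Σ; ∃; _×_)
open import Relation.Nullary using (¬_)
open import Relation.Binary.PropositionalEquality using (_≡_; _≢_)
open import Relation.Binary.Construct.Closure.ReflexiveTransitive using (Star)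
open import Function.Definitions using (Injective)

-- A digraph on vertex set Fin n: an arc relation (no parallel arcs by construction).
Digraph : ℕ → Set₁
Digraph n = Fin n → Fin n → Set

Loopless : ∀ {n} → Digraph n → Set
Loopless D = ∀ x → ¬ D x x

IsRooted : ∀ {n} → Digraph n → Fin n → Set
IsRooted D r = Loopless D × (∀ x → ¬ D x r)

removeArc : ∀ {n} → Digraph n → Fin n → Fin n → Digraph n
removeArc D u v x y = D x y × ¬ (x ≡ u × y ≡ v)

Reachable : ∀ {n} → Digraph n → Fin n → Fin n → Set
Reachable D r w = Star D r w

IsCutEdge : ∀ {n} → Digraph n → Fin n → Fin n → Fin n → Set
IsCutEdge D r u v = D u v × ∃ λ w → ¬ Reachable (removeArc D u v) r w

-- An outbranching of D rooted at r: a spanning subgraph B of D in which r has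
-- in-degree 0, every other vertex has in-degree exactly 1, and every vertex is
-- reachable from r; equivalently an oriented spanning tree with all arcs
-- directed away from r.
record Outbranching {n} (D : Digraph n) (r : Fin n) : Set₁ where
  field
    B        : Digraph n
    sub      : ∀ x y → B x y → D x y
    rootIn   : ∀ x → ¬ B x r
    inDeg1   : ∀ y → y ≢ r → Σ (Fin n) λ x → B x y × (∀ x′ → B x′ y → x′ ≡ x)
    reach    : ∀ y → Star B r y

  IsLeaf : Fin n → Set
  IsLeaf x = ∀ y → ¬ B x y

HasAtLeastLeaves : ∀ {n} {D : Digraph n} {r : Fin n} → Outbranching D r → ℕ → Set
HasAtLeastLeaves {n} O k =
  Σ (Fin k → Fin n) λ f → Injective _≡_ _≡_ f × (∀ i → Outbranching.IsLeaf O (f i))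

HasOutbranchingWithLeaves : ∀ {n} → Digraph n → Fin n → ℕ → Set₁
HasOutbranchingWithLeaves D r k = Σ (Outbranching D r) λ O → HasAtLeastLeaves O k

module Submission where

-- An outbranching B of D is transported verbatim to any digraph
-- D′ that contains all arcs of B; the leaves are unchanged, since being a
-- leaf only depends on B.  So it suffices to see that every outbranching of D
-- avoids the arc (v,u), and that every outbranching of D - (v,u) is one of D
-- (which is immediate).
--   For the first point we use two general facts about an outbranching B:
--   * B has no 2-cycle: if B a b and B b a then {a,b} is closed under
--     B-predecessors (in-arcs are unique) and misses the root, so no vertex
--     of it is reachable from r along B, contradicting spanning reachability;
--   * B uses every cut-edge (u,v): otherwise B lies in D - (u,v), which would
--     then reach every vertex from r.
-- Hence if B contained (v,u), then B could not also contain (u,v) (2-cycle),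
-- so B would avoid the cut-edge (u,v), which is impossible.

open import Defs
open import Data.Nat using (ℕ)
open import Data.Fin using (Fin)
open import Data.Product using (_×_; _,_; proj₁; proj₂)
open import Data.Sum using (_⊎_; inj₁; inj₂)
open import Data.Empty using (⊥)
open import Function using (id)
open import Relation.Nullary using (¬_)
open import Relation.Binary.PropositionalEquality using (_≡_; _≢_; refl; sym; trans)
open import Relation.Binary.Construct.Closure.ReflexiveTransitive using (Star; ε; _◅_; gmap)

module _ {n} {D : Digraph n} {r : Fin n} (O : Outbranching D r) where
  open Outbranching O

  headNotRoot : ∀ {x y} → B x y → y ≢ r
  headNotRoot bxy refl = rootIn _ bxy

  parentUnique : ∀ {x x′ y} → B x y → B x′ y → x ≡ x′
  parentUnique {x} {x′} {y} bxy bx′y with inDeg1 y (headNotRoot bxy)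
  ... | _ , _ , unique = trans (unique x bxy) (sym (unique x′ bx′y))

  -- A vertex set closed under B-predecessors and not containing the root is
  -- empty, because every vertex is reached from r along B.
  predClosedEmpty : (P : Fin n → Set) → (∀ {x y} → B x y → P y → P x) →
                    ¬ P r → ∀ y → ¬ P y
  predClosedEmpty P closed ¬Pr y Py = ¬Pr (backwards (reach y) Py)
    where
    backwards : ∀ {a b} → Star B a b → P b → P a
    backwards ε            Pb = Pb
    backwards (bac ◅ path) Pb = closed bac (backwards path Pb)

  noTwoCycle : ∀ {a b} → B a b → B b a → ⊥
  noTwoCycle {a} {b} bab bba = predClosedEmpty P closed ¬Pr a (inj₁ refl)
    where
    P : Fin n → Set
    P y = y ≡ a ⊎ y ≡ b

    closed : ∀ {x y} → B x y → P y → P x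
    closed bxa (inj₁ refl) = inj₂ (parentUnique bxa bba)
    closed bxb (inj₂ refl) = inj₁ (parentUnique bxb bab)

    ¬Pr : ¬ P r
    ¬Pr (inj₁ refl) = headNotRoot bba refl
    ¬Pr (inj₂ refl) = headNotRoot bab refl

  -- An outbranching uses every cut-edge (u,v): if it avoided it, it would be
  -- a spanning reachability structure inside D - (u,v).
  usesCutEdge : ∀ {u v} → IsCutEdge D r u v →
                ¬ (∀ {x y} → B x y → ¬ (x ≡ u × y ≡ v))
  usesCutEdge (_ , w , unreachable) avoids =
    unreachable (gmap id (λ {x} {y} bxy → sub x y bxy , avoids bxy) (reach w))

  avoidsReversedCutEdge : ∀ {u v} → IsCutEdge D r u v → ¬ B v u
  avoidsReversedCutEdge ce bvu =
    usesCutEdge ce λ { buv (refl , refl) → noTwoCycle buv bvu }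

transferOutbranching :
  ∀ {n} {D D′ : Digraph n} {r : Fin n} {k : ℕ} →
  ((O : Outbranching D r) → ∀ x y → Outbranching.B O x y → D′ x y) →
  HasOutbranchingWithLeaves D r k → HasOutbranchingWithLeaves D′ r k
transferOutbranching inside (O , leaves) = record
  { B      = B
  ; sub    = inside O
  ; rootIn = rootIn
  ; inDeg1 = inDeg1
  ; reach  = reach
  } , leaves
  where open Outbranching O

lemma9 : ∀ {n} (D : Digraph n) (r u v : Fin n) → IsRooted D r →
         IsCutEdge D r u v → D v u → (k : ℕ) →
         (HasOutbranchingWithLeaves D r k → HasOutbranchingWithLeaves (removeArc D v u) r k)
         × (HasOutbranchingWithLeaves (removeArc D v u) r k → HasOutbranchingWithLeaves D r k)
-- Forward: outbranchings of D avoid (v,u).  Backward: D - (v,u) ⊆ D.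
lemma9 D r u v _ cutEdge _ k =
  transferOutbranching avoidsVU , transferOutbranching (λ O x y b → proj₁ (Outbranching.sub O x y b))
  where
  avoidsVU : (O : Outbranching D r) → ∀ x y → Outbranching.B O x y → removeArc D v u x y
  avoidsVU O x y bxy =
    Outbranching.sub O x y bxy , λ { (refl , refl) → avoidsReversedCutEdge O cutEdge bxy }
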